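{- Let $s,s'\ge1$, $B:=B(s'\omega_1)\otimes B(s\omega_1)$ of type $A_2$, $C:=B\oplus B'$ a type $A_2$ crystal having $B$ as a direct summand, and $\mathrm{pr}$ a promotion operator on $C$ such that $\mathrm{pr}^k(u)=\mathfrak{pr}^k(u)$ for every $u$ in the inversionless component of $B$ and every $k\ge0$. Then for every $w:=v'\otimes v\in B$ such that $v'$ and $v$ each contain precisely two distinct letters, $\mathrm{pr}^k(w)=\mathfrak{pr}^k(w)$ for all $k\ge0$.
   Context: Type $A_2$ over $\{1,2,3\}$: $B(s\omega_1)$ is the set of weakly increasing words of length $s$, weight $=$ content. For $i\in\{1,2\}$, $e_i,f_i$ on $v'\otimes v$ act via the bracketing rule on the concatenated word $v'v$ (letters $i\mapsto$ ")", $i+1\mapsto$ "(", match "()"; $f_i$ changes the $i$ of the rightmost unmatched ")" into $i+1$, $e_i$ the $i+1$ of the leftmost unmatched "(" into $i$, else $\emptyset$). A type $A_2$ crystal $C$ here is a disjoint union of tensor products of type $A_2$ highest weight tableau crystals. A promotion operator on $C$ is a map $\mathrm{pr}:C\to C$ with (1) $\mathrm{wt}(b)=(w_1,w_2,w_3)\Rightarrow\mathrm{wt}(\mathrm{pr}(b))=(w_3,w_1,w_2)$; (2) $\mathrm{pr}^3=\mathrm{id}$; (3) $\mathrm{pr}\circ e_1=e_2\circ\mathrm{pr}$, $\mathrm{pr}\circ f_1=f_2\circ\mathrm{pr}$. The canonical promotion on $B$ is $\mathfrak{pr}(v'\otimes v)=\mathfrak{pr}(v')\otimes\mathfrak{pr}(v)$,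 where on a row $v$, $\mathfrak{pr}(v)$ removes the letters $3$, puts that many $0$s at the front and adds $1$ to every letter. The inversionless component of $B$ is the connected component of $B$ (under $e_1,e_2,f_1,f_2$) containing $1^{s'}\otimes 1^s$. -}

module Defs where

open import Data.Nat using (ℕ; zero; suc; _≤_; _<_; _≡ᵇ_)
open import Data.Nat.Properties using (_≟_)
open import Data.Bool using (Bool; true; false; if_then_else_)
open import Data.List using (List; []; _∷_; _++_; map; concat; concatMap; reverse;
  length; take; drop; filter; replicate)
open import Data.List.Relation.Unary.All using (All)
open import Data.List.Relation.Unary.Linked using (Linked)
open import Data.List.Membership.Propositional using (_∈_)
open import Data.Maybe using (Maybe; just; nothing)
import Data.Maybe as Maybe
open import Data.Product using (Σ; _×_; _,_; proj₁; proj₂; ∃₂)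
open import Data.Sum using (_⊎_)
open import Data.Unit using (⊤)
open import Data.Empty using (⊥)
open import Relation.Binary.PropositionalEquality using (_≡_; _≢_)
open import Relation.Nullary using (¬_)
open import Relation.Nullary.Decidable using (does)

-- Words, letters 1,2,3 are the naturals 1,2,3.

Word : Set
Word = List ℕ

iter : {A : Set} → (A → A) → ℕ → A → A
iter f zero x = x
iter f (suc k) x = f (iter f k x)

count : ℕ → Word → ℕ
count a w = length (filter (λ x → x ≟ a) w)

-- Bracketing rule.
-- marks o c n w : scanning w left to right with n currently unmatched
-- openers (letter o); returns true exactly at unmatched closers (letter c).

private
  closeStep : ℕ → Bool
  closeStep zero = true
  closeStep (suc _) = false

  closeCount : ℕ → ℕ
  closeCount zero = zero
  closeCount (suc m) = m

marks : ℕ → ℕ → ℕ → Word → List Bool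
marks o c n [] = []
marks o c n (x ∷ xs) =
  if x ≡ᵇ o then false ∷ marks o c (suc n) xs
  else if x ≡ᵇ c then closeStep n ∷ marks o c (closeCount n) xs
  else false ∷ marks o c n xs

lastTrue : List Bool → Maybe ℕ
lastTrue [] = nothing
lastTrue (b ∷ bs) with lastTrue bs
... | just k = just (suc k)
... | nothing = if b then just zero else nothing

setAt : ℕ → ℕ → Word → Word
setAt k a [] = []
setAt zero a (x ∷ xs) = a ∷ xs
setAt (suc k) a (x ∷ xs) = x ∷ setAt k a xs

-- letter i ↦ ")", letter i+1 ↦ "(".
-- f_i: change the i of the rightmost unmatched ")" into i+1.
fWord : ℕ → Word → Maybe Word
fWord i w = Maybe.map (λ k → setAt k (suc i) w) (lastTrue (marks (suc i) i zero w))

-- e_i: change the i+1 of the leftmost unmatched "(" into i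
-- (scan the reversed word, where "(" plays the role of a closer).
eWord : ℕ → Word → Maybe Word
eWord i w = Maybe.map (λ k → reverse (setAt k i (reverse w)))
                      (lastTrue (marks i (suc i) zero (reverse w)))

-- A tableau is its list of rows, top row first.
-- Its reading word reads the rows from bottom to top, each left to right
-- (consistent with the convention that the word of v' ⊗ v is v'v).

Row : Set
Row = List ℕ

Tableau : Set
Tableau = List Row

readTab : Tableau → Word
readTab t = concat (reverse t)

Tensor : Set
Tensor = List Tableau

readTensor : Tensor → Word
readTensor = concatMap readTab

shapeTab : Tableau → List ℕ
shapeTab = map length

fillRows : List Row → Word → List Row × Word
fillRows [] w = [] , w
fillRows (r ∷ rs) w with fillRows rs (drop (length r) w)
... | (rs' , w') = (take (length r) w ∷ rs') , w'

fillTab : Tableau → Word → Tableau × Word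
fillTab t w with fillRows (reverse t) w
... | (rs , w') = reverse rs , w'

fillTensor : Tensor → Word → Tensor
fillTensor [] w = []
fillTensor (t ∷ ts) w with fillTab t w
... | (t' , w') = t' ∷ fillTensor ts w'

Letter : ℕ → Set
Letter x = 1 ≤ x × x ≤ 3

-- column strictness between an upper row and the row below it
-- (also forces the lower row to be no longer than the upper one)
ColStrict : Row → Row → Set
ColStrict _ [] = ⊤
ColStrict [] (_ ∷ _) = ⊥
ColStrict (a ∷ as) (b ∷ bs) = (a < b) × ColStrict as bs

record SSYT (t : Tableau) : Set where
  field
    rowsNonempty : All (λ r → 0 < length r) t
    letters      : All (All Letter) t
    rowsWeak     : All (Linked _≤_) t
    colsStrict   : Linked ColStrict t

-- A type A₂ crystal: disjoint union of tensor products of highest weight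
-- tableau crystals.  It is described by a list of components, each
-- component a list of shapes (one per tensor factor).

Components : Set
Components = List (List (List ℕ))

nth : {A : Set} → List A → ℕ → Maybe A
nth [] _ = nothing
nth (x ∷ _) zero = just x
nth (_ ∷ xs) (suc n) = nth xs n

-- raw element: (index of component, tensor of fillings)
Raw : Set
Raw = ℕ × Tensor

Valid : Components → Raw → Set
Valid L (j , ts) = (nth L j ≡ just (map shapeTab ts)) × All SSYT ts

record Elt (L : Components) : Set where
  constructor elt
  field
    raw   : Raw
    valid : Valid L raw

open Elt public

eR : ℕ → Raw → Maybe Raw
eR i (j , ts) = Maybe.map (λ w → j , fillTensor ts w) (eWord i (readTensor ts))

fR : ℕ → Raw → Maybe Raw
fR i (j , ts) = Maybe.map (λ w → j , fillTensor ts w) (fWord i (readTensor ts))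

wt : Raw → ℕ × ℕ × ℕ
wt (_ , ts) = count 1 (readTensor ts) , count 2 (readTensor ts) , count 3 (readTensor ts)

rot : ℕ × ℕ × ℕ → ℕ × ℕ × ℕ
rot (w₁ , w₂ , w₃) = w₃ , w₁ , w₂

record IsPromotion (L : Components) (pr : Elt L → Elt L) : Set where
  field
    weight : ∀ b → wt (raw (pr b)) ≡ rot (wt (raw b))
    order3 : ∀ b → raw (pr (pr (pr b))) ≡ raw b
    e-just    : ∀ b b' → eR 1 (raw b) ≡ just (raw b') → eR 2 (raw (pr b)) ≡ just (raw (pr b'))
    e-nothing : ∀ b → eR 1 (raw b) ≡ nothing → eR 2 (raw (pr b)) ≡ nothing
    f-just    : ∀ b b' → fR 1 (raw b) ≡ just (raw b') → fR 2 (raw (pr b)) ≡ just (raw (pr b'))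
    f-nothing : ∀ b → fR 1 (raw b) ≡ nothing → fR 2 (raw (pr b)) ≡ nothing

-- B = B(s'ω₁) ⊗ B(sω₁), as a direct summand of C: it is component 0.

shapesB : ℕ → ℕ → List (List ℕ)
shapesB s' s = (s' ∷ []) ∷ (s ∷ []) ∷ []

CompC : ℕ → ℕ → Components → Components
CompC s' s L' = shapesB s' s ∷ L'

BElt : Set
BElt = Row × Row

ι : BElt → Raw
ι (v' , v) = zero , ((v' ∷ []) ∷ (v ∷ []) ∷ [])

prRow : Row → Row
prRow v = map suc (replicate (count 3 v) 0 ++ filter (λ x → ¬? (x ≟ 3)) v)
  where open import Relation.Nullary.Decidable using (¬?)

prB : BElt → BElt
prB (v' , v) = prRow v' , prRow v

Idx : ℕ → Set
Idx i = (i ≡ 1) ⊎ (i ≡ 2)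

data Inversionless (s' s : ℕ) : Raw → Set where
  base : Inversionless s' s (ι (replicate s' 1 , replicate s 1))
  viaE : ∀ {x y} i → Idx i → Inversionless s' s x → eR i x ≡ just y → Inversionless s' s y
  viaF : ∀ {x y} i → Idx i → Inversionless s' s x → fR i x ≡ just y → Inversionless s' s y

TwoLetters : Word → Set
TwoLetters v = ∃₂ λ a b → (a ≢ b) × (a ∈ v) × (b ∈ v) × (∀ c → c ∈ v → (c ≡ a) ⊎ (c ≡ b))

module Submission where

-- Write an element of B as 1^a 2^b 3^c ⊗ 1^d 2^e 3^f, so that 𝔭𝔯 rotates (a, b, c) and
-- (d, e, f), and call it good if pr agrees with 𝔭𝔯 on it.  Goodness spreads along f₁-edges of B
-- in both directions: forwards because pr f₁ = f₂ pr and 𝔭𝔯 f₁ = f₂ 𝔭𝔯, backwards because f₂ is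
-- injective on B.  Since pr³ = id, if p and 𝔭𝔯 p are good then so is 𝔭𝔯² p.  By hypothesis the
-- images under 𝔭𝔯 of the inversionless elements 1^{s'} ⊗ v and v' ⊗ 3^s are good.  Every element
-- without 3 in its left row is joined by an f₁-string to some 2^{s'} ⊗ v = 𝔭𝔯 (1^{s'} ⊗ ·), every
-- element without 3 in its right row to some v' ⊗ 1^s = 𝔭𝔯 (· ⊗ 3^s); the remaining cases where
-- both rows miss a letter follow by the orbit rule and one more f₁-string.  Missing a letter is
-- preserved by 𝔭𝔯, so pr and 𝔭𝔯 agree along the whole orbit.

open import Defs
open import Axiom.UniquenessOfIdentityProofs.WithK using (uip)
open import Data.Bool using (Bool; true; false)
open import Data.Empty using (⊥; ⊥-elim)
open import Data.List using (List; []; _∷_; _++_; replicate; length; take; drop; map; filter)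
open import Data.List.Membership.Propositional.Properties using (∈-++⁺ʳ)
open import Data.List.Properties
  using (length-replicate; length-++; ++-assoc; ++-identityʳ; take-all; ∷-injectiveˡ; ∷-injectiveʳ)
open import Data.List.Relation.Unary.All as All using (All; []; _∷_)
open import Data.List.Relation.Unary.Any using (here)
open import Data.List.Relation.Unary.Linked as Linked using (Linked; []; [-]; _∷_)
open import Data.Maybe using (Maybe; just; nothing)
open import Data.Maybe.Properties using (just-injective)
open import Data.Nat using (ℕ; zero; suc; pred; _+_; _≡ᵇ_; _≤_; _<_; z≤n; s≤s)
open import Data.Nat.Properties
  using (+-suc; +-identityʳ; +-comm; +-assoc; ≤-refl; ≤-irrelevant; m≢1+n+m; _≟_)
open import Data.Nat.Tactic.RingSolver using (solve-∀)
open import Data.Product using (Σ; ∃; _×_; _,_; proj₁; proj₂)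
open import Data.Sum using (_⊎_; inj₁; inj₂)
open import Function using (_∘_)
open import Function.Bundles using (_⇔_; mk⇔; Equivalence)
open import Function.Construct.Composition using (_⇔-∘_)
open import Function.Construct.Identity using (⇔-id)
open import Function.Construct.Symmetry using (⇔-sym)
open import Relation.Binary.PropositionalEquality
open import Relation.Nullary.Decidable using (¬?)
open import Relation.Nullary.Irrelevant using (Irrelevant)

iter-invariant : ∀ {A : Set} (P : A → Set) {f : A → A} → (∀ {a} → P a → P (f a)) →
  ∀ {a} → P a → ∀ k → P (iter f k a)
iter-invariant P step pa zero = pa
iter-invariant P step pa (suc k) = step (iter-invariant P step pa k)

iter-natural : ∀ {A B : Set} {f : B → B} {g : A → B} {h : A → A} → (∀ a → f (g a) ≡ g (h a)) →
  ∀ k a → iter f k (g a) ≡ g (iter h k a)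
iter-natural commutes zero a = refl
iter-natural {f = f} commutes (suc k) a = trans (cong f (iter-natural commutes k a)) (commutes _)

offset-split : ∀ m n → (∃ λ k → n ≡ m + suc k) ⊎ (∃ λ k → m ≡ k + n)
offset-split m zero = inj₂ (m , sym (+-identityʳ m))
offset-split zero (suc n) = inj₁ (n , refl)
offset-split (suc m) (suc n) with offset-split m n
... | inj₁ (k , n≡) = inj₁ (k , cong suc n≡)
... | inj₂ (k , m≡) = inj₂ (k , trans (cong suc m≡) (sym (+-suc k n)))

-- Bracketing on words made of blocks of equal letters

falses trues : ℕ → List Bool
falses k = replicate k false
trues k = replicate k true

module _ (o c : ℕ) where

  marks-openers : ∀ {x} → (x ≡ᵇ o) ≡ true → ∀ k n w →
    marks o c n (replicate k x ++ w) ≡ falses k ++ marks o c (k + n) w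
  marks-openers x≡o zero n w = refl
  marks-openers x≡o (suc k) n w rewrite x≡o = cong (false ∷_)
    (trans (marks-openers x≡o k (suc n) w) (cong (λ m → falses k ++ marks o c m w) (+-suc k n)))

  marks-neutrals : ∀ {x} → (x ≡ᵇ o) ≡ false → (x ≡ᵇ c) ≡ false → ∀ k n w →
    marks o c n (replicate k x ++ w) ≡ falses k ++ marks o c n w
  marks-neutrals x≢o x≢c zero n w = refl
  marks-neutrals x≢o x≢c (suc k) n w rewrite x≢o | x≢c = cong (false ∷_) (marks-neutrals x≢o x≢c k n w)

  marks-closers-matched : ∀ {x} → (x ≡ᵇ o) ≡ false → (x ≡ᵇ c) ≡ true → ∀ k n w →
    marks o c (k + n) (replicate k x ++ w) ≡ falses k ++ marks o c n w
  marks-closers-matched x≢o x≡c zero n w = refl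
  marks-closers-matched x≢o x≡c (suc k) n w rewrite x≢o | x≡c =
    cong (false ∷_) (marks-closers-matched x≢o x≡c k n w)

  marks-closers-unmatched : ∀ {x} → (x ≡ᵇ o) ≡ false → (x ≡ᵇ c) ≡ true → ∀ n k w →
    marks o c n (replicate (n + k) x ++ w) ≡ falses n ++ trues k ++ marks o c 0 w
  marks-closers-unmatched {x} x≢o x≡c zero k w = unmatched k
    where
    unmatched : ∀ k → marks o c 0 (replicate k x ++ w) ≡ trues k ++ marks o c 0 w
    unmatched zero = refl
    unmatched (suc k) rewrite x≢o | x≡c = cong (true ∷_) (unmatched k)
  marks-closers-unmatched x≢o x≡c (suc n) k w
    rewrite x≢o | x≡c = cong (false ∷_) (marks-closers-unmatched x≢o x≡c n k w)

lastTrue-++-just : ∀ xs {ys k} → lastTrue ys ≡ just k → lastTrue (xs ++ ys) ≡ just (length xs + k)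
lastTrue-++-just [] ys≡ = ys≡
lastTrue-++-just (x ∷ xs) {ys} ys≡ rewrite lastTrue-++-just xs {ys} ys≡ = refl

lastTrue-++-nothing : ∀ xs {ys} → lastTrue ys ≡ nothing → lastTrue (xs ++ ys) ≡ lastTrue xs
lastTrue-++-nothing [] ys≡ = ys≡
lastTrue-++-nothing (x ∷ xs) {ys} ys≡ rewrite lastTrue-++-nothing xs {ys} ys≡ = refl

lastTrue-falses : ∀ k → lastTrue (falses k) ≡ nothing
lastTrue-falses zero = refl
lastTrue-falses (suc k) rewrite lastTrue-falses k = refl

lastTrue-trues : ∀ k → lastTrue (trues (suc k)) ≡ just k
lastTrue-trues zero = refl
lastTrue-trues (suc k) rewrite lastTrue-trues k = refl

lastTrue-replicate-++ : ∀ k b {ys j} → lastTrue ys ≡ just j → lastTrue (replicate k b ++ ys) ≡ just (k + j)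
lastTrue-replicate-++ k b {j = j} ys≡ =
  trans (lastTrue-++-just (replicate k b) ys≡) (cong (λ n → just (n + j)) (length-replicate k))

lastTrue-falses-++ : ∀ k {ys} → lastTrue ys ≡ nothing → lastTrue (falses k ++ ys) ≡ nothing
lastTrue-falses-++ k ys≡ = trans (lastTrue-++-nothing (falses k) ys≡) (lastTrue-falses k)

setAt-replicate-++ : ∀ k x {j a ys} → setAt (k + j) a (replicate k x ++ ys) ≡ replicate k x ++ setAt j a ys
setAt-replicate-++ zero x = refl
setAt-replicate-++ (suc k) x = cong (x ∷_) (setAt-replicate-++ k x)

setAt-last-of-replicate : ∀ k x {a ys} → setAt k a (replicate (suc k) x ++ ys) ≡ replicate k x ++ a ∷ ys
setAt-last-of-replicate zero x = refl
setAt-last-of-replicate (suc k) x = cong (x ∷_) (setAt-last-of-replicate k x)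

fWord-just : ∀ i w {k} → lastTrue (marks (suc i) i 0 w) ≡ just k → fWord i w ≡ just (setAt k (suc i) w)
fWord-just i w last≡ rewrite last≡ = refl

fWord-nothing : ∀ i w → lastTrue (marks (suc i) i 0 w) ≡ nothing → fWord i w ≡ nothing
fWord-nothing i w last≡ rewrite last≡ = refl

Content : Set
Content = ℕ × ℕ × ℕ

blocks : Content → Word → Word
blocks (a , b , c) w = replicate a 1 ++ replicate b 2 ++ replicate c 3 ++ w

row : Content → Row
row x = blocks x []

size : Content → ℕ
size (a , b , c) = a + b + c

setAt-blocks : ∀ a b c {j z w} →
  setAt (a + (b + (c + j))) z (blocks (a , b , c) w) ≡ blocks (a , b , c) (setAt j z w)
setAt-blocks a b c = trans (setAt-replicate-++ a 1) (cong (replicate a 1 ++_)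
  (trans (setAt-replicate-++ b 2) (cong (replicate b 2 ++_) (setAt-replicate-++ c 3))))

open ≡-Reasoning

-- For f₁ the letters 1, 2, 3 of a row are closers, openers and neutral; for f₂ they are neutral,
-- closers and openers.

marks₁-unmatched : ∀ n k b c w →
  marks 2 1 n (blocks (n + k , b , c) w) ≡ falses n ++ trues k ++ falses b ++ falses c ++ marks 2 1 b w
marks₁-unmatched n k b c w = begin
  marks 2 1 n (blocks (n + k , b , c) w)
    ≡⟨ marks-closers-unmatched 2 1 refl refl n k _ ⟩
  falses n ++ trues k ++ marks 2 1 0 (replicate b 2 ++ replicate c 3 ++ w)
    ≡⟨ cong (λ t → falses n ++ trues k ++ t) (marks-openers 2 1 refl b 0 _) ⟩
  falses n ++ trues k ++ falses b ++ marks 2 1 (b + 0) (replicate c 3 ++ w)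
    ≡⟨ cong (λ t → falses n ++ trues k ++ falses b ++ t) (marks-neutrals 2 1 refl refl c (b + 0) w) ⟩
  falses n ++ trues k ++ falses b ++ falses c ++ marks 2 1 (b + 0) w
    ≡⟨ cong (λ m → falses n ++ trues k ++ falses b ++ falses c ++ marks 2 1 m w) (+-identityʳ b) ⟩
  falses n ++ trues k ++ falses b ++ falses c ++ marks 2 1 b w ∎

marks₁-matched : ∀ a k b c w →
  marks 2 1 (a + k) (blocks (a , b , c) w) ≡ falses a ++ falses b ++ falses c ++ marks 2 1 (b + k) w
marks₁-matched a k b c w = begin
  marks 2 1 (a + k) (blocks (a , b , c) w)
    ≡⟨ marks-closers-matched 2 1 refl refl a k _ ⟩
  falses a ++ marks 2 1 k (replicate b 2 ++ replicate c 3 ++ w)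
    ≡⟨ cong (falses a ++_) (marks-openers 2 1 refl b k _) ⟩
  falses a ++ falses b ++ marks 2 1 (b + k) (replicate c 3 ++ w)
    ≡⟨ cong (λ t → falses a ++ falses b ++ t) (marks-neutrals 2 1 refl refl c (b + k) w) ⟩
  falses a ++ falses b ++ falses c ++ marks 2 1 (b + k) w ∎

marks₂-unmatched : ∀ a n k c w →
  marks 3 2 n (blocks (a , n + k , c) w) ≡ falses a ++ falses n ++ trues k ++ falses c ++ marks 3 2 c w
marks₂-unmatched a n k c w = begin
  marks 3 2 n (blocks (a , n + k , c) w)
    ≡⟨ marks-neutrals 3 2 refl refl a n _ ⟩
  falses a ++ marks 3 2 n (replicate (n + k) 2 ++ replicate c 3 ++ w)
    ≡⟨ cong (falses a ++_) (marks-closers-unmatched 3 2 refl refl n k _) ⟩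
  falses a ++ falses n ++ trues k ++ marks 3 2 0 (replicate c 3 ++ w)
    ≡⟨ cong (λ t → falses a ++ falses n ++ trues k ++ t) (marks-openers 3 2 refl c 0 w) ⟩
  falses a ++ falses n ++ trues k ++ falses c ++ marks 3 2 (c + 0) w
    ≡⟨ cong (λ m → falses a ++ falses n ++ trues k ++ falses c ++ marks 3 2 m w) (+-identityʳ c) ⟩
  falses a ++ falses n ++ trues k ++ falses c ++ marks 3 2 c w ∎

marks₂-matched : ∀ a b k c w →
  marks 3 2 (b + k) (blocks (a , b , c) w) ≡ falses a ++ falses b ++ falses c ++ marks 3 2 (c + k) w
marks₂-matched a b k c w = begin
  marks 3 2 (b + k) (blocks (a , b , c) w)
    ≡⟨ marks-neutrals 3 2 refl refl a (b + k) _ ⟩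
  falses a ++ marks 3 2 (b + k) (replicate b 2 ++ replicate c 3 ++ w)
    ≡⟨ cong (falses a ++_) (marks-closers-matched 3 2 refl refl b k _) ⟩
  falses a ++ falses b ++ marks 3 2 k (replicate c 3 ++ w)
    ≡⟨ cong (λ t → falses a ++ falses b ++ t) (marks-openers 3 2 refl c k w) ⟩
  falses a ++ falses b ++ falses c ++ marks 3 2 (c + k) w ∎

f₁-word-second-row : ∀ a b c k e f →
  fWord 1 (blocks (a , b , c) (row (b + suc k , e , f))) ≡ just (blocks (a , b , c) (row (b + k , suc e , f)))
f₁-word-second-row a b c k e f = trans (fWord-just 1 _ lastUnmatched) (cong just (begin
  setAt (a + (b + (c + (b + k)))) 2 (blocks (a , b , c) (row (b + suc k , e , f)))
    ≡⟨ setAt-blocks a b c ⟩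
  blocks (a , b , c) (setAt (b + k) 2 (row (b + suc k , e , f)))
    ≡⟨ cong (λ m → blocks (a , b , c) (setAt (b + k) 2 (row (m , e , f)))) (+-suc b k) ⟩
  blocks (a , b , c) (setAt (b + k) 2 (row (suc (b + k) , e , f)))
    ≡⟨ cong (blocks (a , b , c)) (setAt-last-of-replicate (b + k) 1) ⟩
  blocks (a , b , c) (row (b + k , suc e , f)) ∎))
  where
  lastUnmatched : lastTrue (marks 2 1 0 (blocks (a , b , c) (row (b + suc k , e , f))))
                ≡ just (a + (b + (c + (b + k))))
  lastUnmatched = begin
    lastTrue (marks 2 1 0 (blocks (a , b , c) (row (b + suc k , e , f))))
      ≡⟨ cong lastTrue (trans (marks₁-unmatched 0 a b c _)
           (cong (λ t → trues a ++ falses b ++ falses c ++ t) (marks₁-unmatched b (suc k) e f []))) ⟩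
    lastTrue (trues a ++ falses b ++ falses c ++ falses b ++ trues (suc k) ++ falses e ++ falses f ++ [])
      ≡⟨ lastTrue-replicate-++ a true (lastTrue-replicate-++ b false (lastTrue-replicate-++ c false
           (lastTrue-replicate-++ b false (trans (lastTrue-++-nothing (trues (suc k))
             (lastTrue-falses-++ e (lastTrue-falses-++ f refl))) (lastTrue-trues k))))) ⟩
    just (a + (b + (c + (b + k)))) ∎

f₁-word-first-row : ∀ a k d c e f →
  fWord 1 (blocks (suc a , k + d , c) (row (d , e , f))) ≡ just (blocks (a , suc k + d , c) (row (d , e , f)))
f₁-word-first-row a k d c e f =
  trans (fWord-just 1 _ lastUnmatched) (cong just (setAt-last-of-replicate a 1))
  where
  lastUnmatched : lastTrue (marks 2 1 0 (blocks (suc a , k + d , c) (row (d , e , f)))) ≡ just a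
  lastUnmatched = begin
    lastTrue (marks 2 1 0 (blocks (suc a , k + d , c) (row (d , e , f))))
      ≡⟨ cong lastTrue (trans (marks₁-unmatched 0 (suc a) (k + d) c _)
           (cong (λ t → trues (suc a) ++ falses (k + d) ++ falses c ++ t)
             (trans (cong (λ m → marks 2 1 m (row (d , e , f))) (+-comm k d)) (marks₁-matched d k e f [])))) ⟩
    lastTrue (trues (suc a) ++ falses (k + d) ++ falses c ++ falses d ++ falses e ++ falses f ++ [])
      ≡⟨ trans (lastTrue-++-nothing (trues (suc a)) (lastTrue-falses-++ (k + d) (lastTrue-falses-++ c
           (lastTrue-falses-++ d (lastTrue-falses-++ e (lastTrue-falses-++ f refl)))))) (lastTrue-trues a) ⟩
    just a ∎

f₂-word-second-row : ∀ a b c d k f →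
  fWord 2 (blocks (a , b , c) (row (d , c + suc k , f))) ≡ just (blocks (a , b , c) (row (d , c + k , suc f)))
f₂-word-second-row a b c d k f = trans (fWord-just 2 _ lastUnmatched) (cong just (begin
  setAt (a + (b + (c + (d + (c + k))))) 3 (blocks (a , b , c) (row (d , c + suc k , f)))
    ≡⟨ setAt-blocks a b c ⟩
  blocks (a , b , c) (setAt (d + (c + k)) 3 (row (d , c + suc k , f)))
    ≡⟨ cong (blocks (a , b , c)) (setAt-replicate-++ d 1) ⟩
  blocks (a , b , c) (replicate d 1 ++ setAt (c + k) 3 (replicate (c + suc k) 2 ++ replicate f 3 ++ []))
    ≡⟨ cong (λ m → blocks (a , b , c) (replicate d 1 ++ setAt (c + k) 3 (replicate m 2 ++ replicate f 3 ++ [])))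
         (+-suc c k) ⟩
  blocks (a , b , c) (replicate d 1 ++ setAt (c + k) 3 (replicate (suc (c + k)) 2 ++ replicate f 3 ++ []))
    ≡⟨ cong (λ t → blocks (a , b , c) (replicate d 1 ++ t)) (setAt-last-of-replicate (c + k) 2) ⟩
  blocks (a , b , c) (row (d , c + k , suc f)) ∎))
  where
  lastUnmatched : lastTrue (marks 3 2 0 (blocks (a , b , c) (row (d , c + suc k , f))))
                ≡ just (a + (b + (c + (d + (c + k)))))
  lastUnmatched = begin
    lastTrue (marks 3 2 0 (blocks (a , b , c) (row (d , c + suc k , f))))
      ≡⟨ cong lastTrue (trans (marks₂-unmatched a 0 b c _)
           (cong (λ t → falses a ++ trues b ++ falses c ++ t) (marks₂-unmatched d c (suc k) f []))) ⟩
    lastTrue (falses a ++ trues b ++ falses c ++ falses d ++ falses c ++ trues (suc k) ++ falses f ++ [])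
      ≡⟨ lastTrue-replicate-++ a false (lastTrue-replicate-++ b true (lastTrue-replicate-++ c false
           (lastTrue-replicate-++ d false (lastTrue-replicate-++ c false (trans (lastTrue-++-nothing (trues (suc k))
             (lastTrue-falses-++ f refl)) (lastTrue-trues k)))))) ⟩
    just (a + (b + (c + (d + (c + k))))) ∎

f₂-word-first-row : ∀ a b k e d f →
  fWord 2 (blocks (a , suc b , k + e) (row (d , e , f))) ≡ just (blocks (a , b , suc k + e) (row (d , e , f)))
f₂-word-first-row a b k e d f = trans (fWord-just 2 _ lastUnmatched)
  (cong just (trans (setAt-replicate-++ a 1) (cong (replicate a 1 ++_) (setAt-last-of-replicate b 2))))
  where
  lastUnmatched : lastTrue (marks 3 2 0 (blocks (a , suc b , k + e) (row (d , e , f)))) ≡ just (a + b)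
  lastUnmatched = begin
    lastTrue (marks 3 2 0 (blocks (a , suc b , k + e) (row (d , e , f))))
      ≡⟨ cong lastTrue (trans (marks₂-unmatched a 0 (suc b) (k + e) _)
           (cong (λ t → falses a ++ trues (suc b) ++ falses (k + e) ++ t)
             (trans (cong (λ m → marks 3 2 m (row (d , e , f))) (+-comm k e)) (marks₂-matched d e k f [])))) ⟩
    lastTrue (falses a ++ trues (suc b) ++ falses (k + e) ++ falses d ++ falses e ++ falses f ++ [])
      ≡⟨ lastTrue-replicate-++ a false (trans (lastTrue-++-nothing (trues (suc b)) (lastTrue-falses-++ (k + e)
           (lastTrue-falses-++ d (lastTrue-falses-++ e (lastTrue-falses-++ f refl))))) (lastTrue-trues b)) ⟩
    just (a + b) ∎

f₂-word-undefined : ∀ a k e d f → fWord 2 (blocks (a , 0 , k + e) (row (d , e , f))) ≡ nothing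
f₂-word-undefined a k e d f = fWord-nothing 2 (blocks (a , 0 , k + e) (row (d , e , f))) (begin
  lastTrue (marks 3 2 0 (blocks (a , 0 , k + e) (row (d , e , f))))
    ≡⟨ cong lastTrue (trans (marks₂-unmatched a 0 0 (k + e) _)
         (cong (λ t → falses a ++ falses (k + e) ++ t)
           (trans (cong (λ m → marks 3 2 m (row (d , e , f))) (+-comm k e)) (marks₂-matched d e k f [])))) ⟩
  lastTrue (falses a ++ falses (k + e) ++ falses d ++ falses e ++ falses f ++ [])
    ≡⟨ lastTrue-falses-++ a (lastTrue-falses-++ (k + e) (lastTrue-falses-++ d
         (lastTrue-falses-++ e (lastTrue-falses-++ f refl)))) ⟩
  nothing ∎)

-- Elements of B and the crystal operators on them

infix 5 _⊗_
record RowPair : Set where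
  constructor _⊗_
  field
    left right : Content

rows : RowPair → BElt
rows (x ⊗ y) = row x , row y

⟦_⟧ : RowPair → Raw
⟦ p ⟧ = ι (rows p)

word : RowPair → Word
word (x ⊗ y) = blocks x (row y)

sizes : RowPair → ℕ × ℕ
sizes (x ⊗ y) = size x , size y

promote : RowPair → RowPair
promote (x ⊗ y) = rot x ⊗ rot y

sizes-promote : ∀ p → sizes (promote p) ≡ sizes p
sizes-promote ((a , b , c) ⊗ (d , e , f)) = cong₂ _,_ (rotated a b c) (rotated d e f)
  where
  rotated : ∀ a b c → c + a + b ≡ a + b + c
  rotated = solve-∀

row-++ : ∀ x w → row x ++ w ≡ blocks x w
row-++ (a , b , c) w = trans (++-assoc (replicate a 1) _ w) (cong (replicate a 1 ++_)
  (trans (++-assoc (replicate b 2) _ w) (cong (replicate b 2 ++_) (++-assoc (replicate c 3) [] w))))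

length-row : ∀ x → length (row x) ≡ size x
length-row (a , b , c) = begin
  length (replicate a 1 ++ replicate b 2 ++ replicate c 3 ++ [])
    ≡⟨ length-++ (replicate a 1) ⟩
  length (replicate a 1) + length (replicate b 2 ++ replicate c 3 ++ [])
    ≡⟨ cong₂ _+_ (length-replicate a) (trans (length-++ (replicate b 2))
         (cong₂ _+_ (length-replicate b) (trans (length-++ (replicate c 3)) (+-identityʳ _)))) ⟩
  a + (b + length (replicate c 3))
    ≡⟨ trans (cong (λ n → a + (b + n)) (length-replicate c)) (sym (+-assoc a b c)) ⟩
  a + b + c ∎

length-row-≡ : ∀ x x' → size x ≡ size x' → length (row x) ≡ length (row x')
length-row-≡ x x' eq = trans (length-row x) (trans eq (sym (length-row x')))

readTensor-⟦⟧ : ∀ x y → readTensor (proj₂ ⟦ x ⊗ y ⟧) ≡ word (x ⊗ y)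
readTensor-⟦⟧ x y = trans (cong₂ _++_ (++-identityʳ (row x)) (trans (++-identityʳ _) (++-identityʳ (row y))))
  (row-++ x (row y))

take-length-++ : ∀ (xs ys : List ℕ) → take (length xs) (xs ++ ys) ≡ xs
take-length-++ [] ys = refl
take-length-++ (x ∷ xs) ys = cong (x ∷_) (take-length-++ xs ys)

drop-length-++ : ∀ (xs ys : List ℕ) → drop (length xs) (xs ++ ys) ≡ ys
drop-length-++ [] ys = refl
drop-length-++ (x ∷ xs) ys = drop-length-++ xs ys

fillTensor-⟦⟧ : ∀ x y x' y' → sizes (x ⊗ y) ≡ sizes (x' ⊗ y') →
  fillTensor (proj₂ ⟦ x ⊗ y ⟧) (word (x' ⊗ y')) ≡ proj₂ ⟦ x' ⊗ y' ⟧
fillTensor-⟦⟧ x y x' y' same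
  rewrite sym (row-++ x' (row y'))
        | length-row-≡ x x' (cong proj₁ same) | length-row-≡ y y' (cong proj₂ same)
        | take-length-++ (row x') (row y') | drop-length-++ (row x') (row y')
        | take-all (length (row y')) (row y') ≤-refl = refl

fR-⟦⟧ : ∀ i x y x' y' → fWord i (word (x ⊗ y)) ≡ just (word (x' ⊗ y')) →
  sizes (x ⊗ y) ≡ sizes (x' ⊗ y') → fR i ⟦ x ⊗ y ⟧ ≡ just ⟦ x' ⊗ y' ⟧
fR-⟦⟧ i x y x' y' f≡ same rewrite readTensor-⟦⟧ x y | f≡ =
  cong (λ ts → just (0 , ts)) (fillTensor-⟦⟧ x y x' y' same)

fR-⟦⟧-undefined : ∀ i x y → fWord i (word (x ⊗ y)) ≡ nothing → fR i ⟦ x ⊗ y ⟧ ≡ nothing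
fR-⟦⟧-undefined i x y f≡ rewrite readTensor-⟦⟧ x y | f≡ = refl

fR-index : ∀ i r {r'} → fR i r ≡ just r' → proj₁ r ≡ proj₁ r'
fR-index i (j , ts) f≡ with fWord i (readTensor ts)
fR-index i (j , ts) refl | just _ = refl

f₁-second-row : ∀ a b c k e f →
  fR 1 ⟦ (a , b , c) ⊗ (b + suc k , e , f) ⟧ ≡ just ⟦ (a , b , c) ⊗ (b + k , suc e , f) ⟧
f₁-second-row a b c k e f = fR-⟦⟧ 1 (a , b , c) (b + suc k , e , f) (a , b , c) (b + k , suc e , f)
  (f₁-word-second-row a b c k e f)
  (cong (a + b + c ,_) (sizes≡ b k e f))
  where
  sizes≡ : ∀ b k e f → b + suc k + e + f ≡ b + k + suc e + f
  sizes≡ = solve-∀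

f₁-first-row : ∀ a k d c e f →
  fR 1 ⟦ (suc a , k + d , c) ⊗ (d , e , f) ⟧ ≡ just ⟦ (a , suc k + d , c) ⊗ (d , e , f) ⟧
f₁-first-row a k d c e f = fR-⟦⟧ 1 (suc a , k + d , c) (d , e , f) (a , suc k + d , c) (d , e , f)
  (f₁-word-first-row a k d c e f)
  (cong (_, d + e + f) (sizes≡ a k d c))
  where
  sizes≡ : ∀ a k d c → suc a + (k + d) + c ≡ a + (suc k + d) + c
  sizes≡ = solve-∀

f₂-second-row : ∀ a b c d k f →
  fR 2 ⟦ (a , b , c) ⊗ (d , c + suc k , f) ⟧ ≡ just ⟦ (a , b , c) ⊗ (d , c + k , suc f) ⟧
f₂-second-row a b c d k f = fR-⟦⟧ 2 (a , b , c) (d , c + suc k , f) (a , b , c) (d , c + k , suc f)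
  (f₂-word-second-row a b c d k f)
  (cong (a + b + c ,_) (sizes≡ d c k f))
  where
  sizes≡ : ∀ d c k f → d + (c + suc k) + f ≡ d + (c + k) + suc f
  sizes≡ = solve-∀

f₂-first-row : ∀ a b k e d f →
  fR 2 ⟦ (a , suc b , k + e) ⊗ (d , e , f) ⟧ ≡ just ⟦ (a , b , suc k + e) ⊗ (d , e , f) ⟧
f₂-first-row a b k e d f = fR-⟦⟧ 2 (a , suc b , k + e) (d , e , f) (a , b , suc k + e) (d , e , f)
  (f₂-word-first-row a b k e d f)
  (cong (_, d + e + f) (sizes≡ a b k e))
  where
  sizes≡ : ∀ a b k e → a + suc b + (k + e) ≡ a + b + (suc k + e)
  sizes≡ = solve-∀

f₂-undefined : ∀ a k e d f → fR 2 ⟦ (a , 0 , k + e) ⊗ (d , e , f) ⟧ ≡ nothing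
f₂-undefined a k e d f = fR-⟦⟧-undefined 2 (a , 0 , k + e) (d , e , f) (f₂-word-undefined a k e d f)

record F₁Step (p q : RowPair) : Set where
  field
    f₁-step          : fR 1 ⟦ p ⟧ ≡ just ⟦ q ⟧
    f₂-promoted-step : fR 2 ⟦ promote p ⟧ ≡ just ⟦ promote q ⟧
    same-sizes       : sizes p ≡ sizes q

step-second-row : ∀ a b c k e f →
  F₁Step ((a , b , c) ⊗ (b + suc k , e , f)) ((a , b , c) ⊗ (b + k , suc e , f))
step-second-row a b c k e f = record
  { f₁-step = f₁-second-row a b c k e f
  ; f₂-promoted-step = f₂-second-row c a b f k e
  ; same-sizes = cong (a + b + c ,_) (sizes≡ b k e f) }
  where
  sizes≡ : ∀ b k e f → b + suc k + e + f ≡ b + k + suc e + f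
  sizes≡ = solve-∀

step-first-row : ∀ a k d c e f →
  F₁Step ((suc a , k + d , c) ⊗ (d , e , f)) ((a , suc k + d , c) ⊗ (d , e , f))
step-first-row a k d c e f = record
  { f₁-step = f₁-first-row a k d c e f
  ; f₂-promoted-step = f₂-first-row c a k d f e
  ; same-sizes = cong (_, d + e + f) (sizes≡ a k d c) }
  where
  sizes≡ : ∀ a k d c → suc a + (k + d) + c ≡ a + (suc k + d) + c
  sizes≡ = solve-∀

count-1-row : ∀ a b c → count 1 (row (a , b , c)) ≡ a
count-1-row (suc a) b c = cong suc (count-1-row a b c)
count-1-row zero (suc b) c = count-1-row zero b c
count-1-row zero zero (suc c) = count-1-row zero zero c
count-1-row zero zero zero = refl

count-2-row : ∀ a b c → count 2 (row (a , b , c)) ≡ b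
count-2-row (suc a) b c = count-2-row a b c
count-2-row zero (suc b) c = cong suc (count-2-row zero b c)
count-2-row zero zero (suc c) = count-2-row zero zero c
count-2-row zero zero zero = refl

count-3-row : ∀ a b c → count 3 (row (a , b , c)) ≡ c
count-3-row (suc a) b c = count-3-row a b c
count-3-row zero (suc b) c = count-3-row zero b c
count-3-row zero zero (suc c) = cong suc (count-3-row zero zero c)
count-3-row zero zero zero = refl

row-injective : ∀ x x' → row x ≡ row x' → x ≡ x'
row-injective (a , b , c) (a' , b' , c') eq = cong₂ _,_ (counted 1 (count-1-row a b c) (count-1-row a' b' c'))
  (cong₂ _,_ (counted 2 (count-2-row a b c) (count-2-row a' b' c'))
              (counted 3 (count-3-row a b c) (count-3-row a' b' c')))
  where
  counted : ∀ l {n n'} → count l (row (a , b , c)) ≡ n → count l (row (a' , b' , c')) ≡ n' → n ≡ n'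
  counted l n≡ n'≡ = trans (sym n≡) (trans (cong (count l) eq) n'≡)

ι-injective : ∀ {b b'} → ι b ≡ ι b' → b ≡ b'
ι-injective {_ , _} {_ , _} refl = refl

⟦⟧-injective : ∀ {p q} → ⟦ p ⟧ ≡ ⟦ q ⟧ → p ≡ q
⟦⟧-injective {x ⊗ y} {x' ⊗ y'} eq =
  cong₂ _⊗_ (row-injective x x' (cong proj₁ rows≡)) (row-injective y y' (cong proj₂ rows≡))
  where rows≡ = ι-injective eq

data F₂Shape : RowPair → Set where
  second-row : ∀ a b c d k f → F₂Shape ((a , b , c) ⊗ (d , c + suc k , f))
  first-row  : ∀ a b k e d f → F₂Shape ((a , suc b , k + e) ⊗ (d , e , f))
  undefined  : ∀ a k e d f → F₂Shape ((a , 0 , k + e) ⊗ (d , e , f))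

f₂-shape : ∀ p → F₂Shape p
f₂-shape ((a , b , c) ⊗ (d , e , f)) with offset-split c e
... | inj₁ (k , refl) = second-row a b c d k f
f₂-shape ((a , zero , c) ⊗ (d , e , f)) | inj₂ (k , refl) = undefined a k e d f
f₂-shape ((a , suc b , c) ⊗ (d , e , f)) | inj₂ (k , refl) = first-row a b k e d f

undo-second-row undo-first-row : RowPair → RowPair
undo-second-row ((a , b , c) ⊗ (d , e , f)) = (a , b , c) ⊗ (d , suc e , pred f)
undo-first-row ((a , b , c) ⊗ (d , e , f)) = (a , suc b , pred c) ⊗ (d , e , f)

f₂-injective : ∀ p q {r} → fR 2 ⟦ p ⟧ ≡ just r → fR 2 ⟦ q ⟧ ≡ just r → p ≡ q
f₂-injective p q = by-shapes (f₂-shape p) (f₂-shape q)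
  where
  same-result : ∀ {p' q'} {m n : Maybe Raw} {r} → m ≡ just ⟦ p' ⟧ → n ≡ just ⟦ q' ⟧ →
    m ≡ just r → n ≡ just r → p' ≡ q'
  same-result fP' fQ' fP fQ =
    ⟦⟧-injective (just-injective (trans (trans (sym fP') fP) (trans (sym fQ) fQ')))

  undone : ∀ a b c d k f →
    (a , b , c) ⊗ (d , c + suc k , f) ≡ undo-second-row ((a , b , c) ⊗ (d , c + k , suc f))
  undone a b c d k f = cong (λ e → (a , b , c) ⊗ (d , e , f)) (+-suc c k)

  -- A second-row result has at least as many 2s on the right as 3s on the left, a first-row
  -- result has fewer.
  crossed : ∀ c k e k' → c ≡ suc k' + e → c + k ≡ e → ⊥
  crossed c k e k' refl c+k≡e = m≢1+n+m e (trans (sym c+k≡e) (reorder k' e k))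
    where
    reorder : ∀ k' e k → suc k' + e + k ≡ suc (k' + k + e)
    reorder = solve-∀

  by-shapes : ∀ {p q r} → F₂Shape p → F₂Shape q →
    fR 2 ⟦ p ⟧ ≡ just r → fR 2 ⟦ q ⟧ ≡ just r → p ≡ q
  by-shapes (undefined a k e d f) _ fp _ with () ← trans (sym (f₂-undefined a k e d f)) fp
  by-shapes _ (undefined a k e d f) _ fq with () ← trans (sym (f₂-undefined a k e d f)) fq
  by-shapes (second-row a b c d k f) (second-row a' b' c' d' k' f') fp fq =
    trans (undone a b c d k f) (trans (cong undo-second-row (same-result
      (f₂-second-row a b c d k f) (f₂-second-row a' b' c' d' k' f') fp fq)) (sym (undone a' b' c' d' k' f')))
  by-shapes (first-row a b k e d f) (first-row a' b' k' e' d' f') fp fq = cong undo-first-row (same-result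
    (f₂-first-row a b k e d f) (f₂-first-row a' b' k' e' d' f') fp fq)
  by-shapes (second-row a b c d k f) (first-row a' b' k' e' d' f') fp fq = ⊥-elim (crossed c k e' k'
    (cong (λ where ((_ , _ , c) ⊗ _) → c) results≡) (cong (λ where (_ ⊗ (_ , e , _)) → e) results≡))
    where
    results≡ : (a , b , c) ⊗ (d , c + k , suc f) ≡ (a' , b' , suc k' + e') ⊗ (d' , e' , f')
    results≡ = same-result (f₂-second-row a b c d k f) (f₂-first-row a' b' k' e' d' f') fp fq
  by-shapes (first-row a b k e d f) (second-row a' b' c' d' k' f') fp fq = ⊥-elim (crossed c' k' e k
    (cong (λ where ((_ , _ , c) ⊗ _) → c) results≡) (cong (λ where (_ ⊗ (_ , e , _)) → e) results≡))
    where
    results≡ : (a' , b' , c') ⊗ (d' , c' + k' , suc f') ≡ (a , b , suc k + e) ⊗ (d , e , f)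
    results≡ = same-result (f₂-second-row a' b' c' d' k' f') (f₂-first-row a b k e d f) fq fp

-- Canonical promotion

filter-row : ∀ a b c → filter (λ x → ¬? (x ≟ 3)) (row (a , b , c)) ≡ row (a , b , 0)
filter-row (suc a) b c = cong (1 ∷_) (filter-row a b c)
filter-row zero (suc b) c = cong (2 ∷_) (filter-row zero b c)
filter-row zero zero (suc c) = filter-row zero zero c
filter-row zero zero zero = refl

map-suc-row : ∀ c a b → map suc (replicate c 0 ++ row (a , b , 0)) ≡ row (c , a , b)
map-suc-row (suc c) a b = cong (1 ∷_) (map-suc-row c a b)
map-suc-row zero (suc a) b = cong (2 ∷_) (map-suc-row zero a b)
map-suc-row zero zero (suc b) = cong (3 ∷_) (map-suc-row zero zero b)
map-suc-row zero zero zero = refl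

prRow-row : ∀ x → prRow (row x) ≡ row (rot x)
prRow-row (a , b , c) rewrite count-3-row a b c | filter-row a b c = map-suc-row c a b

prB-rows : ∀ p → prB (rows p) ≡ rows (promote p)
prB-rows (x ⊗ y) = cong₂ _,_ (prRow-row x) (prRow-row y)

HasZero : Content → Set
HasZero (a , b , c) = (a ≡ 0) ⊎ (b ≡ 0) ⊎ (c ≡ 0)

HasZero-rot : ∀ x → HasZero x → HasZero (rot x)
HasZero-rot _ (inj₁ a≡0) = inj₂ (inj₁ a≡0)
HasZero-rot _ (inj₂ (inj₁ b≡0)) = inj₂ (inj₂ b≡0)
HasZero-rot _ (inj₂ (inj₂ c≡0)) = inj₁ c≡0

BothHaveZero : RowPair → Set
BothHaveZero (x ⊗ y) = HasZero x × HasZero y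

BothHaveZero-promote : ∀ {p} → BothHaveZero p → BothHaveZero (promote p)
BothHaveZero-promote {x ⊗ y} (x-zero , y-zero) = HasZero-rot x x-zero , HasZero-rot y y-zero

twoLetters⇒HasZero : ∀ x → TwoLetters (row x) → HasZero x
twoLetters⇒HasZero (zero , _ , _) _ = inj₁ refl
twoLetters⇒HasZero (suc a , zero , _) _ = inj₂ (inj₁ refl)
twoLetters⇒HasZero (suc a , suc b , zero) _ = inj₂ (inj₂ refl)
twoLetters⇒HasZero (suc a , suc b , suc c) (l , l' , _ , _ , _ , only) = ⊥-elim (pigeonhole
  (only 1 (here refl))
  (only 2 (∈-++⁺ʳ (replicate (suc a) 1) (here refl)))
  (only 3 (∈-++⁺ʳ (replicate (suc a) 1) (∈-++⁺ʳ (replicate (suc b) 2) (here refl)))))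
  where
  pigeonhole : ∀ {l l' : ℕ} → (1 ≡ l) ⊎ (1 ≡ l') → (2 ≡ l) ⊎ (2 ≡ l') → (3 ≡ l) ⊎ (3 ≡ l') → ⊥
  pigeonhole (inj₁ refl) (inj₁ ()) _
  pigeonhole (inj₂ refl) (inj₂ ()) _
  pigeonhole (inj₁ refl) (inj₂ refl) (inj₁ ())
  pigeonhole (inj₁ refl) (inj₂ refl) (inj₂ ())
  pigeonhole (inj₂ refl) (inj₁ refl) (inj₁ ())
  pigeonhole (inj₂ refl) (inj₁ refl) (inj₂ ())

row-letters : ∀ a b c → All Letter (row (a , b , c))
row-letters (suc a) b c = (s≤s z≤n , s≤s z≤n) ∷ row-letters a b c
row-letters zero (suc b) c = (s≤s z≤n , s≤s (s≤s z≤n)) ∷ row-letters zero b c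
row-letters zero zero (suc c) = (s≤s z≤n , s≤s (s≤s (s≤s z≤n))) ∷ row-letters zero zero c
row-letters zero zero zero = []

row-sorted : ∀ a b c → Linked _≤_ (row (a , b , c))
row-sorted (suc (suc a)) b c = ≤-refl ∷ row-sorted (suc a) b c
row-sorted (suc zero) (suc b) c = s≤s z≤n ∷ row-sorted zero (suc b) c
row-sorted (suc zero) zero (suc c) = s≤s z≤n ∷ row-sorted zero zero (suc c)
row-sorted (suc zero) zero zero = [-]
row-sorted zero (suc (suc b)) c = ≤-refl ∷ row-sorted zero (suc b) c
row-sorted zero (suc zero) (suc c) = s≤s (s≤s z≤n) ∷ row-sorted zero zero (suc c)
row-sorted zero (suc zero) zero = [-]
row-sorted zero zero (suc (suc c)) = ≤-refl ∷ row-sorted zero zero (suc c)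
row-sorted zero zero (suc zero) = [-]
row-sorted zero zero zero = []

row-SSYT : ∀ x → 0 < size x → SSYT (row x ∷ [])
row-SSYT (a , b , c) 0<size = record
  { rowsNonempty = subst (0 <_) (sym (length-row (a , b , c))) 0<size ∷ []
  ; letters      = row-letters a b c ∷ []
  ; rowsWeak     = row-sorted a b c ∷ []
  ; colsStrict   = [-] }

sorted-∷-row : ∀ {l} a b c → Letter l → Linked _≤_ (l ∷ row (a , b , c)) →
  ∃ λ x → l ∷ row (a , b , c) ≡ row x
sorted-∷-row a b c (s≤s z≤n , s≤s z≤n) _ = (suc a , b , c) , refl
sorted-∷-row {2} zero b c _ _ = (0 , suc b , c) , refl
sorted-∷-row {2} (suc a) b c _ (s≤s () ∷ _)
sorted-∷-row {3} zero zero c _ _ = (0 , 0 , suc c) , refl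
sorted-∷-row {3} zero (suc b) c _ (s≤s (s≤s ()) ∷ _)
sorted-∷-row {3} (suc a) b c _ (s≤s () ∷ _)
sorted-∷-row {suc (suc (suc (suc _)))} a b c (_ , s≤s (s≤s (s≤s ()))) _

sorted⇒row : ∀ r → All Letter r → Linked _≤_ r → ∃ λ x → r ≡ row x
sorted⇒row [] _ _ = (0 , 0 , 0) , refl
sorted⇒row (l ∷ r) (l-letter ∷ r-letters) l∷r-sorted with sorted⇒row r r-letters (Linked.tail l∷r-sorted)
... | (a , b , c) , refl = sorted-∷-row a b c l-letter l∷r-sorted

Letter-irrelevant : ∀ {x} → Irrelevant (Letter x)
Letter-irrelevant (p , q) (p' , q') = cong₂ _,_ (≤-irrelevant p p') (≤-irrelevant q q')

ColStrict-irrelevant : ∀ r r' → Irrelevant (ColStrict r r')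
ColStrict-irrelevant _ [] _ _ = refl
ColStrict-irrelevant (_ ∷ r) (_ ∷ r') (p , q) (p' , q') =
  cong₂ _,_ (≤-irrelevant p p') (ColStrict-irrelevant r r' q q')

SSYT-irrelevant : ∀ {t} → Irrelevant (SSYT t)
SSYT-irrelevant (record { rowsNonempty = n ; letters = l ; rowsWeak = w ; colsStrict = c })
                (record { rowsNonempty = n' ; letters = l' ; rowsWeak = w' ; colsStrict = c' })
  rewrite All.irrelevant ≤-irrelevant n n'
        | All.irrelevant (All.irrelevant Letter-irrelevant) l l'
        | All.irrelevant (Linked.irrelevant ≤-irrelevant) w w'
        | Linked.irrelevant (λ {r} {r'} → ColStrict-irrelevant r r') c c' = refl

raw-injective : ∀ {L} {u v : Elt L} → raw u ≡ raw v → u ≡ v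
raw-injective {L} {elt r (shape , tableaux)} {elt .r (shape' , tableaux')} refl =
  cong₂ (λ p q → elt r (p , q)) (uip shape shape') (All.irrelevant SSYT-irrelevant tableaux tableaux')

-- Agreement of pr with the canonical promotion

module Crystal (s' s : ℕ) (s'≥1 : 1 ≤ s') (s≥1 : 1 ≤ s) (L' : Components) where

  C : Components
  C = CompC s' s L'

  Fits : RowPair → Set
  Fits p = sizes p ≡ (s' , s)

  fits-unpromote : ∀ p → Fits (promote p) → Fits p
  fits-unpromote p = trans (sym (sizes-promote p))

  element : ∀ p → Fits p → Elt C
  element (x ⊗ y) fits = elt ⟦ x ⊗ y ⟧
    ( cong just (cong₂ (λ m n → (m ∷ []) ∷ (n ∷ []) ∷ [])
        (sym (trans (length-row x) (cong proj₁ fits))) (sym (trans (length-row y) (cong proj₂ fits))))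
    , row-SSYT x (subst (1 ≤_) (sym (cong proj₁ fits)) s'≥1)
    ∷ row-SSYT y (subst (1 ≤_) (sym (cong proj₂ fits)) s≥1) ∷ [])

  component₀ : ∀ {ts} → Valid C (0 , ts) → Σ RowPair λ p → (0 , ts) ≡ ⟦ p ⟧ × Fits p
  component₀ {(r ∷ []) ∷ (r' ∷ []) ∷ []} (shape≡ , t ∷ t' ∷ [])
    with sorted⇒row r (All.head (SSYT.letters t)) (All.head (SSYT.rowsWeak t))
       | sorted⇒row r' (All.head (SSYT.letters t')) (All.head (SSYT.rowsWeak t'))
  ... | x , refl | y , refl = x ⊗ y , refl , cong₂ _,_
    (trans (sym (length-row x)) (sym (∷-injectiveˡ (∷-injectiveˡ shapes≡))))
    (trans (sym (length-row y)) (sym (∷-injectiveˡ (∷-injectiveˡ (∷-injectiveʳ shapes≡)))))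
    where shapes≡ = just-injective shape≡
  component₀ {[]} (() , _)
  component₀ {[] ∷ _} (() , _)
  component₀ {(_ ∷ _ ∷ _) ∷ _} (() , _)
  component₀ {_ ∷ []} (() , _)
  component₀ {_ ∷ [] ∷ _} (() , _)
  component₀ {_ ∷ (_ ∷ _ ∷ _) ∷ _} (() , _)
  component₀ {_ ∷ _ ∷ _ ∷ _} (() , _)

  in-B : ∀ (v : Elt C) → proj₁ (raw v) ≡ 0 → Σ RowPair λ p → raw v ≡ ⟦ p ⟧ × Fits p
  in-B (elt (.0 , ts) valid) refl = component₀ valid

  fits-of : ∀ (v : Elt C) p → raw v ≡ ⟦ p ⟧ → Fits p
  fits-of v p v≡ with in-B v (cong proj₁ v≡)
  ... | p' , v≡' , fits' = subst Fits (⟦⟧-injective {p'} {p} (trans (sym v≡') v≡)) fits'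

  Inv : RowPair → Set
  Inv p = Inversionless s' s ⟦ p ⟧

  inversionless-string : ∀ i → Idx i → (F : ℕ → ℕ → RowPair) →
    (∀ m n → fR i ⟦ F (suc m) n ⟧ ≡ just ⟦ F m (suc n) ⟧) → ∀ m → Inv (F m 0) → Inv (F 0 m)
  inversionless-string i idx F step m inv = subst (λ n → Inv (F 0 n)) (+-identityʳ m) (go m 0 inv)
    where
    go : ∀ m n → Inv (F m n) → Inv (F 0 (m + n))
    go zero n inv = inv
    go (suc m) n inv = subst (λ k → Inv (F 0 k)) (+-suc m n) (go m (suc n) (viaF i idx inv (step m n)))

  inversionless-left-only-1s : ∀ a d e f → Fits ((a , 0 , 0) ⊗ (d , e , f)) → Inv ((a , 0 , 0) ⊗ (d , e , f))
  inversionless-left-only-1s a d e f fits = subst (λ a → Inv ((a , 0 , 0) ⊗ (d , e , f))) s'≡a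
    (inversionless-string 2 (inj₂ refl) (λ m n → (s' , 0 , 0) ⊗ (d , m + e , n))
      (λ m n → f₂-second-row s' 0 0 d (m + e) n) f
    (inversionless-string 1 (inj₁ refl) (λ m n → (s' , 0 , 0) ⊗ (m + d , n , 0))
      (λ m n → f₁-second-row s' 0 0 (m + d) n 0) (f + e)
    (subst (λ n → Inv ((s' , 0 , 0) ⊗ (n , 0 , 0))) s≡ start)))
    where
    start : Inv ((s' , 0 , 0) ⊗ (s , 0 , 0))
    start = subst (λ b → Inversionless s' s (ι b)) (cong₂ _,_ (sym (++-identityʳ _)) (sym (++-identityʳ _))) base
    s'≡a : s' ≡ a
    s'≡a = trans (sym (cong proj₁ fits)) (trans (+-identityʳ (a + 0)) (+-identityʳ a))
    s≡ : s ≡ f + e + d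
    s≡ = trans (sym (cong proj₂ fits)) (reorder d e f)
      where
      reorder : ∀ d e f → d + e + f ≡ f + e + d
      reorder = solve-∀

  inversionless-right-only-3s : ∀ a b c f → Fits ((a , b , c) ⊗ (0 , 0 , f)) → Inv ((a , b , c) ⊗ (0 , 0 , f))
  inversionless-right-only-3s a b c f fits = subst (λ m → Inv ((a , b , m) ⊗ (0 , 0 , f))) (+-identityʳ c)
    (inversionless-string 2 (inj₂ refl) (λ m n → (a , m + b , n + 0) ⊗ (0 , 0 , f))
      (λ m n → f₂-first-row a (m + b) n 0 0 f) c
    (subst (λ m → Inv ((a , m , 0) ⊗ (0 , 0 , f))) (trans (+-identityʳ (b + c)) (+-comm b c))
    (inversionless-string 1 (inj₁ refl) (λ m n → (m + a , n + 0 , 0) ⊗ (0 , 0 , f))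
      (λ m n → f₁-first-row (m + a) n 0 0 0 f) (b + c)
    (inversionless-left-only-1s (b + c + a) 0 0 f
      (cong₂ _,_ (trans (left-size a b c) (cong proj₁ fits)) (cong proj₂ fits))))))
    where
    left-size : ∀ a b c → b + c + a + 0 + 0 ≡ a + b + c
    left-size = solve-∀

  module WithPromotion (pr : Elt C → Elt C) (isPromotion : IsPromotion C pr)
    (pr-inversionless : ∀ (u : Elt C) (b : BElt) → Inversionless s' s (raw u) → raw u ≡ ι b →
                        ∀ k → raw (iter pr k u) ≡ ι (iter prB k b)) where

    open IsPromotion isPromotion

    Agrees : RowPair → Set
    Agrees p = ∀ u → raw u ≡ ⟦ p ⟧ → raw (pr u) ≡ ⟦ promote p ⟧

    agrees-promoted-inversionless : ∀ p → (Fits p → Inv p) → Agrees (promote p)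
    agrees-promoted-inversionless p inv u u≡ = begin
      raw (pr u)                   ≡⟨ cong (raw ∘ pr) u≡pr-u₀ ⟩
      raw (pr (pr u₀))             ≡⟨ pr-inversionless u₀ (rows p) (inv fits-p) refl 2 ⟩
      ι (prB (prB (rows p)))       ≡⟨ cong ι (trans (cong prB (prB-rows p)) (prB-rows (promote p))) ⟩
      ⟦ promote (promote p) ⟧      ∎
      where
      fits-p = fits-unpromote p (fits-of u (promote p) u≡)
      u₀ = element p fits-p
      u≡pr-u₀ : u ≡ pr u₀
      u≡pr-u₀ = raw-injective (trans u≡ (sym
        (trans (pr-inversionless u₀ (rows p) (inv fits-p) refl 1) (cong ι (prB-rows p)))))

    agrees-promote² : ∀ p → Agrees p → Agrees (promote p) → Agrees (promote (promote p))
    agrees-promote² p agrees-p agrees-pr-p u u≡ = begin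
      raw (pr u)                ≡⟨ cong (raw ∘ pr) (raw-injective (trans u≡ (sym at-pr²))) ⟩
      raw (pr (pr (pr u₀)))     ≡⟨ order3 u₀ ⟩
      ⟦ p ⟧                     ∎
      where
      u₀ = element p (fits-unpromote p (fits-unpromote (promote p) (fits-of u (promote (promote p)) u≡)))
      at-pr² : raw (pr (pr u₀)) ≡ ⟦ promote (promote p) ⟧
      at-pr² = agrees-pr-p (pr u₀) (agrees-p u₀ refl)

    agrees-step : ∀ {p q} → F₁Step p q → Agrees p ⇔ Agrees q
    agrees-step {p} {q} step = mk⇔ forward backward
      where
      open F₁Step step
      forward : Agrees p → Agrees q
      forward agrees-p u' u'≡ = just-injective (begin
        just (raw (pr u'))        ≡⟨ f-just u₀ u' (trans f₁-step (cong just (sym u'≡))) ⟨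
        fR 2 (raw (pr u₀))        ≡⟨ cong (fR 2) (agrees-p u₀ refl) ⟩
        fR 2 ⟦ promote p ⟧        ≡⟨ f₂-promoted-step ⟩
        just ⟦ promote q ⟧        ∎)
        where u₀ = element p (trans same-sizes (fits-of u' q u'≡))
      -- f₂ (pr u) = pr (f₁ u) is known, pr u lies in B since f₂ keeps the component, and f₂ is
      -- injective on B.
      backward : Agrees q → Agrees p
      backward agrees-q u u≡ = via (in-B (pr u) (fR-index 2 (raw (pr u)) f₂-pr-u))
        where
        u' = element q (trans (sym same-sizes) (fits-of u p u≡))
        f₂-pr-u : fR 2 (raw (pr u)) ≡ just ⟦ promote q ⟧
        f₂-pr-u = trans (f-just u u' (trans (cong (fR 1) u≡) f₁-step)) (cong just (agrees-q u' refl))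
        via : Σ RowPair (λ r → raw (pr u) ≡ ⟦ r ⟧ × Fits r) → raw (pr u) ≡ ⟦ promote p ⟧
        via (r , pr-u≡ , _) = trans pr-u≡ (cong ⟦_⟧ (f₂-injective r (promote p)
          (trans (cong (fR 2) (sym pr-u≡)) f₂-pr-u) f₂-promoted-step))

    agrees-string : (F : ℕ → ℕ → RowPair) → (∀ m n → F₁Step (F (suc m) n) (F m (suc n))) →
      ∀ {m n m' n'} → m + n ≡ m' + n' → Agrees (F m n) ⇔ Agrees (F m' n')
    agrees-string F step {m} {n} {m'} {n'} same-total =
      ⇔-sym (to-end m' n') ⇔-∘ subst (λ k → Agrees (F m n) ⇔ Agrees (F 0 k)) same-total (to-end m n)
      where
      to-end : ∀ m n → Agrees (F m n) ⇔ Agrees (F 0 (m + n))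
      to-end zero n = ⇔-id _
      to-end (suc m) n = subst (λ k → Agrees (F (suc m) n) ⇔ Agrees (F 0 k)) (+-suc m n)
        (to-end m (suc n) ⇔-∘ agrees-step (step m n))

    agrees-left-only-2s : ∀ b d e f → Agrees ((0 , b , 0) ⊗ (d , e , f))
    agrees-left-only-2s b d e f =
      agrees-promoted-inversionless ((b , 0 , 0) ⊗ (e , f , d)) (inversionless-left-only-1s b e f d)

    agrees-right-only-1s : ∀ a b c d → Agrees ((a , b , c) ⊗ (d , 0 , 0))
    agrees-right-only-1s a b c d =
      agrees-promoted-inversionless ((b , c , a) ⊗ (0 , 0 , d)) (inversionless-right-only-3s b c a d)

    agrees-left-without-3-d≤b : ∀ a k d e f → Agrees ((a , k + d , 0) ⊗ (d , e , f))
    agrees-left-without-3-d≤b a k d e f = Equivalence.from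
      (agrees-string (λ m n → (m , n + d , 0) ⊗ (d , e , f)) (λ m n → step-first-row m n d 0 e f)
        {a} {k} {0} refl)
      (agrees-left-only-2s (a + k + d) d e f)

    agrees-left-without-3-b<d : ∀ a b k e f → Agrees ((a , b , 0) ⊗ (b + suc k , e , f))
    agrees-left-without-3-b<d a b k e f = Equivalence.from
      (agrees-string (λ m n → (a , b , 0) ⊗ (b + m , n , f)) (λ m n → step-second-row a b 0 m n f)
        {suc k} {e} {0} refl)
      (subst (λ m → Agrees ((a , b , 0) ⊗ (m , suc k + e , f))) (sym (+-identityʳ b))
        (agrees-left-without-3-d≤b a 0 b (suc k + e) f))

    agrees-left-without-3 : ∀ a b d e f → Agrees ((a , b , 0) ⊗ (d , e , f))
    agrees-left-without-3 a b d e f with offset-split b d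
    ... | inj₁ (k , refl) = agrees-left-without-3-b<d a b k e f
    ... | inj₂ (k , refl) = agrees-left-without-3-d≤b a k d e f

    agrees-right-without-3-b≤d : ∀ a b c k e → Agrees ((a , b , c) ⊗ (b + k , e , 0))
    agrees-right-without-3-b≤d a b c k e = Equivalence.from
      (agrees-string (λ m n → (a , b , c) ⊗ (b + m , n , 0)) (λ m n → step-second-row a b c m n 0)
        {k} {e} {k + e} {0} (sym (+-identityʳ (k + e))))
      (agrees-right-only-1s a b c (b + (k + e)))

    agrees-right-without-3-d≤b : ∀ a k d c e → Agrees ((a , k + d , c) ⊗ (d , e , 0))
    agrees-right-without-3-d≤b a k d c e = Equivalence.from
      (agrees-string (λ m n → (m , n + d , c) ⊗ (d , e , 0)) (λ m n → step-first-row m n d c e 0)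
        {a} {k} {a + k} {0} (sym (+-identityʳ (a + k))))
      (subst (λ m → Agrees ((a + k , d , c) ⊗ (m , e , 0))) (+-identityʳ d)
        (agrees-right-without-3-b≤d (a + k) d c 0 e))

    agrees-right-without-3 : ∀ a b c d e → Agrees ((a , b , c) ⊗ (d , e , 0))
    agrees-right-without-3 a b c d e with offset-split b d
    ... | inj₁ (k , refl) = agrees-right-without-3-b≤d a b c (suc k) e
    ... | inj₂ (k , refl) = agrees-right-without-3-d≤b a k d c e

    agrees-b≡0-d≡0 : ∀ a c e f → Agrees ((a , 0 , c) ⊗ (0 , e , f))
    agrees-b≡0-d≡0 a c e f = agrees-promote² ((c , a , 0) ⊗ (f , 0 , e))
      (agrees-left-without-3 c a f 0 e) (agrees-right-without-3 0 c a e f)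

    agrees-a≡0-e≡0 : ∀ b c d f → Agrees ((0 , b , c) ⊗ (d , 0 , f))
    agrees-a≡0-e≡0 b c d f = agrees-promote² ((c , 0 , b) ⊗ (f , d , 0))
      (agrees-right-without-3 c 0 b f d) (agrees-left-without-3 b c 0 f d)

    agrees-a≡0-d≡0 : ∀ b c e f → Agrees ((0 , b , c) ⊗ (0 , e , f))
    agrees-a≡0-d≡0 b c e f = subst (λ m → Agrees ((0 , m , c) ⊗ (0 , e , f))) (+-identityʳ b)
      (Equivalence.to
        (agrees-string (λ m n → (m , n + 0 , c) ⊗ (0 , e , f)) (λ m n → step-first-row m n 0 c e f)
          {b} {0} {0} {b} (+-identityʳ b))
        (agrees-b≡0-d≡0 b c e f))

    agrees-b≡0-e≡0 : ∀ a c d f → Agrees ((a , 0 , c) ⊗ (d , 0 , f))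
    agrees-b≡0-e≡0 a c d f = agrees-promote² ((c , a , 0) ⊗ (f , d , 0))
      (agrees-left-without-3 c a f d 0) (agrees-a≡0-d≡0 c a f d)

    agrees-BothHaveZero : ∀ p → BothHaveZero p → Agrees p
    agrees-BothHaveZero ((a , b , _) ⊗ (d , e , _)) (_ , inj₂ (inj₂ refl)) = agrees-right-without-3 a b _ d e
    agrees-BothHaveZero ((a , b , _) ⊗ (d , e , f)) (inj₂ (inj₂ refl) , _) = agrees-left-without-3 a b d e f
    agrees-BothHaveZero ((_ , b , c) ⊗ (_ , e , f)) (inj₁ refl , inj₁ refl) = agrees-a≡0-d≡0 b c e f
    agrees-BothHaveZero ((_ , b , c) ⊗ (d , _ , f)) (inj₁ refl , inj₂ (inj₁ refl)) = agrees-a≡0-e≡0 b c d f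
    agrees-BothHaveZero ((a , _ , c) ⊗ (_ , e , f)) (inj₂ (inj₁ refl) , inj₁ refl) = agrees-b≡0-d≡0 a c e f
    agrees-BothHaveZero ((a , _ , c) ⊗ (d , _ , f)) (inj₂ (inj₁ refl) , inj₂ (inj₁ refl)) = agrees-b≡0-e≡0 a c d f

    agrees-iterated : ∀ p → (∀ k → Agrees (iter promote k p)) →
      ∀ u → raw u ≡ ⟦ p ⟧ → ∀ k → raw (iter pr k u) ≡ ⟦ iter promote k p ⟧
    agrees-iterated p agrees u u≡ zero = u≡
    agrees-iterated p agrees u u≡ (suc k) = agrees k (iter pr k u) (agrees-iterated p agrees u u≡ k)

lemma4p5 : (s' s : ℕ) → 1 ≤ s' → 1 ≤ s → (L' : Components)
    → (pr : Elt (CompC s' s L' ) → Elt (CompC s' s L'))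
    → IsPromotion (CompC s' s L') pr
    → (∀ (u : Elt (CompC s' s L')) (b : BElt) → Inversionless s' s (raw u) → raw u ≡ ι b
         → ∀ k → raw (iter pr k u) ≡ ι (iter prB k b))
    → ∀ (w : Elt (CompC s' s L')) (v' v : Row) → raw w ≡ ι (v' , v)
    → TwoLetters v' → TwoLetters v
    → ∀ k → raw (iter pr k w) ≡ ι (iter prB k (v' , v))
lemma4p5 s' s s'≥1 s≥1 L' pr isPromotion pr-inversionless w v' v w≡ two' two k =
  agree (component₀ (subst (Valid C) w≡ (valid w)))
  where
  open Crystal s' s s'≥1 s≥1 L'
  open WithPromotion pr isPromotion pr-inversionless
  agree : Σ RowPair (λ p → ι (v' , v) ≡ ⟦ p ⟧ × Fits p) → raw (iter pr k w) ≡ ι (iter prB k (v' , v))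
  agree (x ⊗ y , ι≡ , _) = begin
    raw (iter pr k w)                 ≡⟨ agrees-iterated (x ⊗ y) agrees w (trans w≡ ι≡) k ⟩
    ⟦ iter promote k (x ⊗ y) ⟧        ≡⟨ cong ι (iter-natural {g = rows} prB-rows k (x ⊗ y)) ⟨
    ι (iter prB k (rows (x ⊗ y)))     ≡⟨ cong (ι ∘ iter prB k) rows≡ ⟨
    ι (iter prB k (v' , v))           ∎
    where
    rows≡ : (v' , v) ≡ rows (x ⊗ y)
    rows≡ = ι-injective ι≡
    zeros : BothHaveZero (x ⊗ y)
    zeros = twoLetters⇒HasZero x (subst TwoLetters (cong proj₁ rows≡) two')
          , twoLetters⇒HasZero y (subst TwoLetters (cong proj₂ rows≡) two)
    agrees : ∀ k → Agrees (iter promote k (x ⊗ y))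
    agrees k = agrees-BothHaveZero _ (iter-invariant BothHaveZero BothHaveZero-promote zeros k)
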